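{- Let $n\ge3$ and let $\mathsf{C}_n(t;i,i+1)$ be the graph obtained from the cycle graph on vertices $v_1,\dots,v_n$ (edges $v_a v_{a+1}$ for $1\le a\le n-1$ and $v_nv_1$) by adding one further edge between $v_i$ and $v_{i+1}$, where $2\le t\le\lceil n/2\rceil$ and $1\le i<t$, with marked (ramified) vertices $v_1$ and $v_t$. Then \[ F_2(\mathsf{C}_n(t;i,i+1))=\begin{cases} n-1 & \text{if } i=1\text{ and }t=2,\\ (2t-3)(n-t+1) & \text{otherwise.}\end{cases} \]
   Context: For a graph with two marked vertices, $F_2$ is the number of spanning forests with exactly two connected components, each containing exactly one marked vertex. -}

module Defs where

open import Data.Nat using (ℕ; suc; _∸_; NonZero; _<ᵇ_)
open import Data.Nat.DivMod using (_mod_)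
open import Data.Bool using (if_then_else_)
open import Data.Fin using (Fin; toℕ)
open import Data.Fin.Subset using (Subset; _∈_)
open import Data.List using (List; []; _∷_; length)
open import Data.List.Relation.Unary.Unique.Propositional using (Unique)
open import Data.Product using (Σ; _×_; _,_; ∃)
open import Data.Sum using (_⊎_)
open import Relation.Binary.PropositionalEquality using (_≡_)
open import Relation.Nullary using (¬_)
open import Function.Bundles using (_⇔_)

-- A finite multigraph: vertices Fin V, edges Fin E (parallel edges allowed),
-- each edge has an (unordered) pair of endpoints.
record Multigraph : Set where
  field
    V    : ℕ
    E    : ℕ
    ends : Fin E → Fin V × Fin V
open Multigraph public

Joins : (G : Multigraph) → Fin (E G) → Fin (V G) → Fin (V G) → Set
Joins G e u w = ends G e ≡ (u , w) ⊎ ends G e ≡ (w , u)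

-- Walk in the spanning subgraph with edge set S, from u to v, traversing
-- the edge list es, visiting the vertex list vs (all vertices except the last).
data Walk (G : Multigraph) (S : Subset (E G)) :
     Fin (V G) → Fin (V G) → List (Fin (E G)) → List (Fin (V G)) → Set where
  nil  : ∀ {u} → Walk G S u u [] []
  cons : ∀ {u w v es vs} (e : Fin (E G)) → e ∈ S → Joins G e u w →
         Walk G S w v es vs → Walk G S u v (e ∷ es) (u ∷ vs)

Connected : (G : Multigraph) → Subset (E G) → Fin (V G) → Fin (V G) → Set
Connected G S u v = Σ (List (Fin (E G))) λ es → Σ (List (Fin (V G))) λ vs → Walk G S u v es vs

HasCycle : (G : Multigraph) → Subset (E G) → Set
HasCycle G S = Σ (Fin (V G)) λ u → Σ (Fin (E G)) λ e → Σ (List (Fin (E G))) λ es →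
  Σ (List (Fin (V G))) λ vs →
  Walk G S u u (e ∷ es) vs × Unique (e ∷ es) × Unique vs

IsSpanningForest : (G : Multigraph) → Subset (E G) → Set
IsSpanningForest G S = ¬ HasCycle G S

IsTwoRootedForest : (G : Multigraph) → Fin (V G) → Fin (V G) → Subset (E G) → Set
IsTwoRootedForest G a b S =
  IsSpanningForest G S × ¬ Connected G S a b ×
  (∀ v → Connected G S v a ⊎ Connected G S v b)

HasCount : ∀ {m} → (Subset m → Set) → ℕ → Set
HasCount {m} P k = Σ (List (Subset m)) λ xs →
  length xs ≡ k × Unique xs × (∀ S → (S ∈ₗ xs) ⇔ P S)
  where
  open import Data.List.Membership.Propositional renaming (_∈_ to _∈ₗ_)

F₂≡ : (G : Multigraph) → Fin (V G) → Fin (V G) → ℕ → Set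
F₂≡ G a b k = HasCount (IsTwoRootedForest G a b) k

-- C_n(t; i, i+1): vertices v_1..v_n are 0..n-1 (v_a ↦ a-1);
-- edge j < n joins v_{j+1}, v_{j+2 mod n}; edge n is the extra edge v_i v_{i+1}.
Cn : (n i : ℕ) .{{_ : NonZero n}} → Multigraph
Cn n i = record
  { V = n
  ; E = suc n
  ; ends = λ j → if toℕ j <ᵇ n
                   then (toℕ j mod n , suc (toℕ j) mod n)
                   else ((i ∸ 1) mod n , i mod n)
  }

vtx : (n a : ℕ) .{{_ : NonZero n}} → Fin n
vtx n a = (a ∸ 1) mod n

{-# OPTIONS --safe #-}
module Submission where

-- Up to the choice of copy of the doubled edge, a spanning forest whose two trees separate v_1
-- and v_t is the cycle with one edge removed from each of the two arcs between the roots: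
-- t − 1 choices on the arc v_1 … v_t and n − t + 1 on the arc back. The forest may use either
-- copy of the doubled edge v_i v_{i+1} unless its position is the removed one, so the first arc
-- contributes (t − 1) + (t − 2) = 2t − 3 choices; for i = 1, t = 2 the product is n − 1.
-- Acyclicity, separation of the roots and covering all rest on one fact: an arc of consecutive
-- vertices is closed under every forest edge other than those at its two end positions.

open import Defs
open import Data.Bool using (Bool; true; false; not; T; if_then_else_)
open import Data.Empty using (⊥; ⊥-elim)
open import Data.Fin using (Fin; toℕ; fromℕ; fromℕ<; inject₁; punchIn; punchOut)
open import Data.Fin.Properties
  using (toℕ-injective; toℕ-fromℕ; toℕ-fromℕ<; toℕ-inject₁; toℕ<n; fromℕ≢inject₁;
         punchIn-injective; punchInᵢ≢i; punchIn-punchOut; any?)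
  renaming (_≟_ to _≟ᶠ_)
open import Data.Fin.Subset using (Subset; _∈_; _⊆_; ∁; ⁅_⁆; _∪_)
open import Data.Fin.Subset.Properties
  using (_∈?_; ⊆-antisym; x∈∁p⇒x∉p; x∉p⇒x∈∁p; x∈p∪q⁺; x∈p∪q⁻; x∈⁅x⁆; x∈⁅y⁆⇒x≡y)
open import Data.List using (List; []; _∷_; _++_; map; upTo; allFin; length; cartesianProduct)
open import Data.List.Properties using (length-++; length-map; length-upTo; length-tabulate)
open import Data.List.Membership.Propositional using () renaming (_∈_ to _∈ₗ_)
open import Data.List.Membership.Propositional.Properties
  using (∈-map⁺; ∈-map⁻; ∈-++⁺ˡ; ∈-++⁺ʳ; ∈-++⁻; ∈-upTo⁺; ∈-upTo⁻; ∈-allFin;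
         ∈-cartesianProduct⁺; ∈-cartesianProduct⁻)
open import Data.List.Relation.Unary.All as All using (All; []; _∷_)
open import Data.List.Relation.Unary.All.Properties using () renaming (map⁺ to All-map⁺)
open import Data.List.Relation.Unary.Any using (here; there)
open import Data.List.Relation.Unary.AllPairs using ([]; _∷_)
open import Data.List.Relation.Unary.Unique.Propositional using (Unique)
open import Data.List.Relation.Unary.Unique.Propositional.Properties
  using (map⁺; ++⁺; upTo⁺; allFin⁺; cartesianProduct⁺)
open import Data.Nat
  using (ℕ; suc; NonZero; _≤_; _<_; _*_; _+_; _∸_; ⌈_/2⌉; _<ᵇ_; _%_;
         z≤n; s≤s; z<s; s≤s⁻¹; _≤′_; ≤′-refl; ≤′-step)
open import Data.Nat.DivMod using (_mod_; m<n⇒m%n≡m; n%n≡0)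
open import Data.Nat.Properties
open import Data.Product using (Σ; ∃; ∃₂; _×_; _,_; proj₁; proj₂)
open import Data.Product.Properties using (,-injective; ,-injectiveˡ)
open import Data.Sum using (_⊎_; inj₁; inj₂; [_,_])
import Data.Sum as Sum
open import Data.Unit using (⊤; tt)
open import Function using (_∘_; id; const)
open import Function.Bundles using (mk⇔)
open import Relation.Binary.Definitions using (tri<; tri≈; tri>)
open import Relation.Binary.PropositionalEquality
  using (_≡_; _≢_; refl; sym; trans; cong; cong₂; subst; subst₂; module ≡-Reasoning)
open import Relation.Nullary using (¬_; Dec; yes; no)
open import Relation.Nullary.Decidable using (_×-dec_)

-- Walks, connectivity and cycles in a multigraph

module _ {G : Multigraph} {S : Subset (E G)} where

  Joins-sym : ∀ {e x y} → Joins G e x y → Joins G e y x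
  Joins-sym (inj₁ eq) = inj₂ eq
  Joins-sym (inj₂ eq) = inj₁ eq

  Walk-++ : ∀ {u v w es es′ vs vs′} →
    Walk G S u v es vs → Walk G S v w es′ vs′ → Walk G S u w (es ++ es′) (vs ++ vs′)
  Walk-++ nil q = q
  Walk-++ (cons e e∈S J p) q = cons e e∈S J (Walk-++ p q)

  Connected-refl : ∀ {u} → Connected G S u u
  Connected-refl = [] , [] , nil

  Connected-trans : ∀ {u v w} → Connected G S u v → Connected G S v w → Connected G S u w
  Connected-trans (_ , _ , p) (_ , _ , q) = _ , _ , Walk-++ p q

  Joins⇒Connected : ∀ {e x y} → e ∈ S → Joins G e x y → Connected G S x y
  Joins⇒Connected e∈S J = _ , _ , cons _ e∈S J nil

  Connected-sym : ∀ {u v} → Connected G S u v → Connected G S v u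
  Connected-sym (_ , _ , nil) = Connected-refl
  Connected-sym (_ , _ , cons e e∈S J p) =
    Connected-trans (Connected-sym (_ , _ , p)) (Joins⇒Connected e∈S (Joins-sym J))

  Closed : (Fin (E G) → Set) → (Fin (V G) → Set) → Set
  Closed A P = ∀ {e x y} → e ∈ S → A e → Joins G e x y → P x → P y

  Closed-¬ : ∀ {A P} → Closed A P → Closed A (¬_ ∘ P)
  Closed-¬ closed e∈S Ae J ¬Px Py = ¬Px (closed e∈S Ae (Joins-sym J) Py)

  Walk-preserves : ∀ {A P u v es vs} → Closed A P → Walk G S u v es vs → All A es → P u → P v
  Walk-preserves closed nil [] Pu = Pu
  Walk-preserves closed (cons e e∈S J p) (Ae ∷ As) Pu =
    Walk-preserves closed p As (closed e∈S Ae J Pu)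

  Connected-preserves : ∀ {P u v} → Closed (const ⊤) P → Connected G S u v → P u → P v
  Connected-preserves closed (es , _ , p) = Walk-preserves closed p (All.universal (const tt) es)

  acyclic-if-cut :
    (∀ {e} → e ∈ S → Σ (Fin (V G) → Set) λ P →
       Closed (e ≢_) P × P (proj₁ (ends G e)) × ¬ P (proj₂ (ends G e))) →
    ¬ HasCycle G S
  acyclic-if-cut cut (u , e , es , vs , cons _ e∈S J p , (e∉es ∷ _) , _)
    with cut e∈S | J
  ... | P , closed , Pl , ¬Pr | inj₁ eq =
    Walk-preserves (Closed-¬ closed) p e∉es (subst (¬_ ∘ P ∘ proj₂) eq ¬Pr) (subst (P ∘ proj₁) eq Pl)
  ... | P , closed , Pl , ¬Pr | inj₂ eq =
    subst (¬_ ∘ P ∘ proj₂) eq ¬Pr (Walk-preserves closed p e∉es (subst (P ∘ proj₁) eq Pl))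

  parallel⇒HasCycle : ∀ {e f x y} → e ≢ f → e ∈ S → f ∈ S →
    Joins G e x y → Joins G f x y → x ≢ y → HasCycle G S
  parallel⇒HasCycle {e} {f} {x} {y} e≢f e∈S f∈S Je Jf x≢y =
    x , e , f ∷ [] , x ∷ y ∷ [] ,
    cons e e∈S Je (cons f f∈S (Joins-sym Jf) nil) ,
    (e≢f ∷ []) ∷ [] ∷ [] , (x≢y ∷ []) ∷ [] ∷ []

-- Counting by an explicit enumeration

module _ {A B : Set} where

  Unique-map⁺-on : ∀ {f : A → B} {xs} → (∀ {x y} → x ∈ₗ xs → y ∈ₗ xs → f x ≡ f y → x ≡ y) →
    Unique xs → Unique (map f xs)
  Unique-map⁺-on inj [] = []
  Unique-map⁺-on inj (x∉xs ∷ xs!) =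
    All-map⁺ (All.tabulate λ y∈xs fx≡fy → All.lookup x∉xs y∈xs (inj (here refl) (there y∈xs) fx≡fy))
    ∷ Unique-map⁺-on (λ x∈ y∈ → inj (there x∈) (there y∈)) xs!

  length-cartesianProduct : ∀ (xs : List A) (ys : List B) →
    length (cartesianProduct xs ys) ≡ length xs * length ys
  length-cartesianProduct [] ys = refl
  length-cartesianProduct (x ∷ xs) ys = begin
    length (map (x ,_) ys ++ cartesianProduct xs ys)
      ≡⟨ length-++ (map (x ,_) ys) ⟩
    length (map (x ,_) ys) + length (cartesianProduct xs ys)
      ≡⟨ cong₂ _+_ (length-map (x ,_) ys) (length-cartesianProduct xs ys) ⟩
    length ys + length xs * length ys
      ∎
    where open ≡-Reasoning

HasCount-enumeration : ∀ {m} {C : Set} {P : Subset m → Set} (enc : C → Subset m) {cs : List C} →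
  Unique cs → (∀ {κ κ′} → κ ∈ₗ cs → κ′ ∈ₗ cs → enc κ ≡ enc κ′ → κ ≡ κ′) →
  (∀ {κ} → κ ∈ₗ cs → P (enc κ)) → (∀ {S} → P S → ∃ λ κ → κ ∈ₗ cs × enc κ ≡ S) →
  HasCount P (length cs)
HasCount-enumeration {P = P} enc {cs} cs! enc-inj sound complete =
  map enc cs , length-map enc cs , Unique-map⁺-on enc-inj cs! , λ S → mk⇔ (to S) from
  where
  to : ∀ S → S ∈ₗ map enc cs → P S
  to S S∈ with ∈-map⁻ enc S∈
  ... | κ , κ∈cs , refl = sound κ∈cs
  from : ∀ {S} → P S → S ∈ₗ map enc cs
  from PS with complete PS
  ... | κ , κ∈cs , refl = ∈-map⁺ enc κ∈cs

-- Vertices are 0-based (v_a is vertex a − 1), so the roots are 0 and tp = t − 1 and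
-- the doubled edge v_i v_{i+1} lies at position ip = i − 1; the edge at position j
-- joins j and j + 1 mod n.
module TwoRootedForests (n tq ip : ℕ) .{{_ : NonZero n}} (ip≤tq : ip ≤ tq) (tp<n : suc tq < n) where

  tp : ℕ
  tp = suc tq

  ip<tp : ip < tp
  ip<tp = s≤s ip≤tq

  ip<n : ip < n
  ip<n = <-trans ip<tp tp<n

  0<n : 0 < n
  0<n = <-trans z<s tp<n

  G : Multigraph
  G = Cn n (suc ip)

  vx : ℕ → Fin n
  vx k = k mod n

  toℕ-vx : ∀ {k} → k < n → toℕ (vx k) ≡ k
  toℕ-vx k<n = trans (toℕ-fromℕ< _) (m<n⇒m%n≡m k<n)

  toℕ-vx-suc : ∀ {p} → p < n → toℕ (vx (suc p)) ≡ suc p ⊎ (toℕ (vx (suc p)) ≡ 0 × suc p ≡ n)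
  toℕ-vx-suc {p} p<n with m≤n⇒m<n∨m≡n p<n
  ... | inj₁ sp<n = inj₁ (toℕ-vx sp<n)
  ... | inj₂ sp≡n = inj₂ (trans (toℕ-fromℕ< _) (trans (cong (_% n) sp≡n) (n%n≡0 n)) , sp≡n)

  vx-toℕ : ∀ v → vx (toℕ v) ≡ v
  vx-toℕ v = toℕ-injective (toℕ-vx (toℕ<n v))

  vx-n≡vx-0 : vx n ≡ vx 0
  vx-n≡vx-0 = toℕ-injective (trans (toℕ-fromℕ< _) (trans (n%n≡0 n) (sym (toℕ-vx 0<n))))

  -- n ≥ 2, as n > tp ≥ 1
  vx≢vx-suc : ∀ {p} → p < n → vx p ≢ vx (suc p)
  vx≢vx-suc {p} p<n eq with toℕ-vx-suc p<n
  ... | inj₁ eq′ = <-irrefl (trans (sym (toℕ-vx p<n)) (trans (cong toℕ eq) eq′)) (n<1+n p)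
  ... | inj₂ (eq′ , sp≡n) = <-irrefl (trans (cong suc p≡0) sp≡n) (≤-trans (s≤s z<s) tp<n)
    where
    p≡0 : 0 ≡ p
    p≡0 = sym (trans (sym (toℕ-vx p<n)) (trans (cong toℕ eq) eq′))

  cyc : ℕ → Fin (suc n)
  cyc j = inject₁ (vx j)

  extra : Fin (suc n)
  extra = fromℕ n

  pos : Fin (suc n) → ℕ
  pos f = if toℕ f <ᵇ n then toℕ f else ip

  ends-pos : ∀ f → ends G f ≡ (vx (pos f) , vx (suc (pos f)))
  ends-pos f with toℕ f <ᵇ n
  ... | true = refl
  ... | false = refl

  Joins-pos : ∀ f → Joins G f (vx (pos f)) (vx (suc (pos f)))
  Joins-pos f = inj₁ (ends-pos f)

  Joins⇒pos : ∀ {f x y} → Joins G f x y →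
    (x ≡ vx (pos f) × y ≡ vx (suc (pos f))) ⊎ (y ≡ vx (pos f) × x ≡ vx (suc (pos f)))
  Joins⇒pos {f} (inj₁ eq) = inj₁ (,-injective (trans (sym eq) (ends-pos f)))
  Joins⇒pos {f} (inj₂ eq) = inj₂ (,-injective (trans (sym eq) (ends-pos f)))

  pos-cases : ∀ f → (toℕ f < n × pos f ≡ toℕ f) ⊎ (toℕ f ≡ n × pos f ≡ ip)
  pos-cases f with toℕ f <ᵇ n in eq
  ... | true = inj₁ (<ᵇ⇒< (toℕ f) n (subst T (sym eq) tt) , refl)
  ... | false = inj₂ (≤-antisym (s≤s⁻¹ (toℕ<n f)) (≮⇒≥ (λ lt → subst T eq (<⇒<ᵇ lt))) , refl)

  pos<n : ∀ f → pos f < n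
  pos<n f with pos-cases f
  ... | inj₁ (f<n , eq) = subst (_< n) (sym eq) f<n
  ... | inj₂ (_ , eq) = subst (_< n) (sym eq) ip<n

  toℕ-cyc : ∀ {j} → j < n → toℕ (cyc j) ≡ j
  toℕ-cyc j<n = trans (toℕ-inject₁ _) (toℕ-vx j<n)

  cyc≢extra : ∀ {j} → cyc j ≢ extra
  cyc≢extra = fromℕ≢inject₁ ∘ sym

  cyc-injective : ∀ {j k} → j < n → k < n → cyc j ≡ cyc k → j ≡ k
  cyc-injective j<n k<n eq = trans (sym (toℕ-cyc j<n)) (trans (cong toℕ eq) (toℕ-cyc k<n))

  pos-cyc : ∀ {j} → j < n → pos (cyc j) ≡ j
  pos-cyc {j} j<n with pos-cases (cyc j)
  ... | inj₁ (_ , eq) = trans eq (toℕ-cyc j<n)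
  ... | inj₂ (eq , _) = ⊥-elim (<-irrefl (trans (sym (toℕ-cyc j<n)) eq) j<n)

  pos-extra : pos extra ≡ ip
  pos-extra with pos-cases extra
  ... | inj₁ (lt , _) = ⊥-elim (<-irrefl (toℕ-fromℕ n) lt)
  ... | inj₂ (_ , eq) = eq

  extra-or-cyc : ∀ f → f ≡ extra ⊎ f ≡ cyc (pos f)
  extra-or-cyc f with pos-cases f
  ... | inj₁ (_ , eq) = inj₂ (toℕ-injective (trans (sym eq) (sym (toℕ-cyc (pos<n f)))))
  ... | inj₂ (eq , _) = inj₁ (toℕ-injective (trans eq (sym (toℕ-fromℕ n))))

  twins : ∀ {f g} → f ≢ g → pos f ≡ pos g → (f ≡ extra × g ≡ cyc ip) ⊎ (f ≡ cyc ip × g ≡ extra)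
  twins {f} {g} f≢g eq with extra-or-cyc f | extra-or-cyc g
  ... | inj₁ refl | inj₁ refl = ⊥-elim (f≢g refl)
  ... | inj₁ refl | inj₂ g≡ = inj₁ (refl , trans g≡ (cong cyc (trans (sym eq) pos-extra)))
  ... | inj₂ f≡ | inj₁ refl = inj₂ (trans f≡ (cong cyc (trans eq pos-extra)) , refl)
  ... | inj₂ f≡ | inj₂ g≡ = ⊥-elim (f≢g (trans f≡ (trans (cong cyc eq) (sym g≡))))

  -- The vertices between the edges at positions lo and hi.
  InArc : ℕ → ℕ → ℕ → Set
  InArc lo hi k = lo < k × k ≤ hi

  ¬InArc-0 : ∀ {lo hi} → ¬ InArc lo hi (toℕ (vx 0))
  ¬InArc-0 (lo<0 , _) with subst (_ <_) (toℕ-vx 0<n) lo<0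
  ... | ()

  InArc-forward : ∀ {lo hi p} → hi < n → p < n → p ≢ hi →
    InArc lo hi (toℕ (vx p)) → InArc lo hi (toℕ (vx (suc p)))
  InArc-forward {lo} {hi} {p} hi<n p<n p≢hi in-arc with subst (InArc lo hi) (toℕ-vx p<n) in-arc
  ... | lo<p , p≤hi =
    subst (InArc lo hi) (sym (toℕ-vx (≤-<-trans p<hi hi<n))) (m<n⇒m<1+n lo<p , p<hi)
    where
    p<hi : p < hi
    p<hi = ≤∧≢⇒< p≤hi p≢hi

  InArc-backward : ∀ {lo hi p} → p < n → p ≢ lo →
    InArc lo hi (toℕ (vx (suc p))) → InArc lo hi (toℕ (vx p))
  InArc-backward {lo} {hi} {p} p<n p≢lo in-arc with toℕ-vx-suc p<n
  ... | inj₂ (eq , _) = ⊥-elim (¬InArc-0 (subst (InArc lo hi) (trans eq (sym (toℕ-vx 0<n))) in-arc))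
  ... | inj₁ eq with subst (InArc lo hi) eq in-arc
  ...   | lo<sp , sp≤hi =
    subst (InArc lo hi) (sym (toℕ-vx p<n)) (≤∧≢⇒< (s≤s⁻¹ lo<sp) (p≢lo ∘ sym) , ≤-trans (n≤1+n p) sp≤hi)

  InArc-closed : ∀ {S A lo hi} → hi < n → (∀ {f} → f ∈ S → A f → pos f ≢ lo × pos f ≢ hi) →
    Closed {G} {S} A (InArc lo hi ∘ toℕ)
  InArc-closed hi<n avoids {f} f∈S Af J with avoids f∈S Af | Joins⇒pos J
  ... | _ , p≢hi | inj₁ (refl , refl) = InArc-forward hi<n (pos<n f) p≢hi
  ... | p≢lo , _ | inj₂ (refl , refl) = InArc-backward (pos<n f) p≢lo

  InArc-exit : ∀ {lo hi} → lo < hi → hi < n →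
    InArc lo hi (toℕ (vx hi)) × ¬ InArc lo hi (toℕ (vx (suc hi)))
  InArc-exit {lo} {hi} lo<hi hi<n = subst (InArc lo hi) (sym (toℕ-vx hi<n)) (lo<hi , ≤-refl) , outside
    where
    outside : ¬ InArc lo hi (toℕ (vx (suc hi)))
    outside in-arc with toℕ-vx-suc hi<n
    ... | inj₁ eq = 1+n≰n (subst (_≤ hi) eq (proj₂ in-arc))
    ... | inj₂ (eq , _) = ¬InArc-0 (subst (InArc lo hi) (trans eq (sym (toℕ-vx 0<n))) in-arc)

  InArc-entry : ∀ {lo hi} → lo < hi → hi < n →
    ¬ InArc lo hi (toℕ (vx lo)) × InArc lo hi (toℕ (vx (suc lo)))
  InArc-entry {lo} {hi} lo<hi hi<n =
    (λ in-arc → <-irrefl refl (subst (lo <_) (toℕ-vx (<-trans lo<hi hi<n)) (proj₁ in-arc))) ,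
    subst (InArc lo hi) (sym (toℕ-vx (≤-<-trans lo<hi hi<n))) (≤-refl , lo<hi)

  Used : Subset (suc n) → ℕ → Set
  Used S j = ∃ λ f → f ∈ S × pos f ≡ j

  Used? : ∀ S j → Dec (Used S j)
  Used? S j = any? λ f → f ∈? S ×-dec pos f ≟ j

  Used⇒Connected : ∀ {S j} → Used S j → Connected G S (vx j) (vx (suc j))
  Used⇒Connected (f , f∈S , refl) = Joins⇒Connected f∈S (Joins-pos f)

  connected-or-gap : ∀ {S lo hi} → lo ≤′ hi →
    Connected G S (vx lo) (vx hi) ⊎ ∃ λ j → lo ≤ j × j < hi × ¬ Used S j
  connected-or-gap ≤′-refl = inj₁ Connected-refl
  connected-or-gap {S} (≤′-step {h} lo≤′h) with Used? S h | connected-or-gap lo≤′h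
  ... | no ¬used | _ = inj₂ (h , ≤′⇒≤ lo≤′h , ≤-refl , ¬used)
  ... | yes used | inj₁ c = inj₁ (Connected-trans c (Used⇒Connected used))
  ... | yes _ | inj₂ (j , lo≤j , j<h , ¬used) = inj₂ (j , lo≤j , m<n⇒m<1+n j<h , ¬used)

  record CutAt (S : Subset (suc n)) (a b : ℕ) : Set where
    field
      a<tp : a < tp
      tp≤b : tp ≤ b
      b<n : b < n
      a-unused : ¬ Used S a
      b-unused : ¬ Used S b
      others-used : ∀ {j} → j < n → j ≢ a → j ≢ b → Used S j
      pos-injective : ∀ {f g} → f ∈ S → g ∈ S → pos f ≡ pos g → f ≡ g

  module _ {S a b} (cut : CutAt S a b) where
    open CutAt cut

    pos≢a : ∀ {f} → f ∈ S → pos f ≢ a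
    pos≢a f∈S eq = a-unused (_ , f∈S , eq)

    pos≢b : ∀ {f} → f ∈ S → pos f ≢ b
    pos≢b f∈S eq = b-unused (_ , f∈S , eq)

    unused⇒cut : ∀ {x} → x < n → ¬ Used S x → x ≡ a ⊎ x ≡ b
    unused⇒cut {x} x<n ¬used with x ≟ a | x ≟ b
    ... | yes x≡a | _ = inj₁ x≡a
    ... | no _ | yes x≡b = inj₂ x≡b
    ... | no x≢a | no x≢b = ⊥-elim (¬used (others-used x<n x≢a x≢b))

    private
      a<n : a < n
      a<n = <-trans a<tp tp<n

      a<b : a < b
      a<b = <-≤-trans a<tp tp≤b

      Avoids : ℕ → ℕ → ℕ → Set
      Avoids lo hi x = x < lo ⊎ hi ≤ x

      path : ∀ {lo hi} → lo ≤ hi → hi ≤ n → Avoids lo hi a → Avoids lo hi b →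
        Connected G S (vx lo) (vx hi)
      path {lo} {hi} lo≤hi hi≤n avoids-a avoids-b with connected-or-gap {S} (≤⇒≤′ lo≤hi)
      ... | inj₁ c = c
      ... | inj₂ (j , lo≤j , j<hi , ¬used) =
        ⊥-elim (¬used (others-used (<-≤-trans j<hi hi≤n) (avoid avoids-a) (avoid avoids-b)))
        where
        avoid : ∀ {x} → Avoids lo hi x → j ≢ x
        avoid (inj₁ x<lo) refl = <⇒≱ x<lo lo≤j
        avoid (inj₂ hi≤x) refl = <⇒≱ j<hi hi≤x

      separated : ¬ Connected G S (vx 0) (vx tp)
      separated c = Connected-preserves (Closed-¬ closed) c ¬InArc-0
                      (subst (InArc a b) (sym (toℕ-vx tp<n)) (a<tp , tp≤b))
        where
        closed : Closed (const ⊤) (InArc a b ∘ toℕ)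
        closed = InArc-closed b<n λ f∈S _ → pos≢a f∈S , pos≢b f∈S

      covered : ∀ v → Connected G S v (vx 0) ⊎ Connected G S v (vx tp)
      covered v with toℕ v ≤? a | toℕ v ≤? b
      ... | yes k≤a | _ =
        inj₁ (subst (λ u → Connected G S u (vx 0)) (vx-toℕ v)
               (Connected-sym (path z≤n (<⇒≤ (toℕ<n v)) (inj₂ k≤a) (inj₂ (≤-trans k≤a (<⇒≤ a<b))))))
      ... | no k≰a | yes k≤b =
        inj₂ (Connected-trans (Connected-sym from-a) (path a<tp (<⇒≤ tp<n) (inj₁ ≤-refl) (inj₂ tp≤b)))
        where
        from-a : Connected G S (vx (suc a)) v
        from-a = subst (Connected G S (vx (suc a))) (vx-toℕ v)
                   (path (≰⇒> k≰a) (<⇒≤ (toℕ<n v)) (inj₁ ≤-refl) (inj₂ k≤b))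
      ... | no k≰a | no k≰b = inj₁ (subst₂ (Connected G S) (vx-toℕ v) vx-n≡vx-0
                                     (path (<⇒≤ (toℕ<n v)) ≤-refl (inj₁ (≰⇒> k≰a)) (inj₁ (≰⇒> k≰b))))

      acyclic : ¬ HasCycle G S
      acyclic = acyclic-if-cut λ {f} f∈S → let P , closed , crossing = cut-at f∈S in
        P , closed , subst (λ e → P (proj₁ e) × ¬ P (proj₂ e)) (sym (ends-pos f)) crossing
        where
        pos-apart : ∀ {f g} → f ∈ S → g ∈ S → f ≢ g → pos g ≢ pos f
        pos-apart f∈S g∈S f≢g eq = f≢g (pos-injective f∈S g∈S (sym eq))

        cut-at : ∀ {f} → f ∈ S → Σ (Fin n → Set) λ P →
          Closed (f ≢_) P × P (vx (pos f)) × ¬ P (vx (suc (pos f)))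
        cut-at {f} f∈S with <-cmp (pos f) a
        ... | tri< p<a _ _ =
          ¬_ ∘ InArc (pos f) a ∘ toℕ ,
          Closed-¬ (InArc-closed a<n λ g∈S f≢g → pos-apart f∈S g∈S f≢g , pos≢a g∈S) ,
          proj₁ (InArc-entry p<a a<n) , λ ¬in-arc → ¬in-arc (proj₂ (InArc-entry p<a a<n))
        ... | tri≈ _ p≡a _ = ⊥-elim (pos≢a f∈S p≡a)
        ... | tri> _ _ a<p =
          InArc a (pos f) ∘ toℕ ,
          InArc-closed (pos<n f) (λ g∈S f≢g → pos≢a g∈S , pos-apart f∈S g∈S f≢g) ,
          InArc-exit a<p (pos<n f)

    CutAt⇒IsTwoRootedForest : IsTwoRootedForest G (vx 0) (vx tp) S
    CutAt⇒IsTwoRootedForest = acyclic , separated , covered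

  module _ {S} (forest : IsTwoRootedForest G (vx 0) (vx tp) S) where
    private
      acyclic : ¬ HasCycle G S
      acyclic = proj₁ forest

      separated : ¬ Connected G S (vx 0) (vx tp)
      separated = proj₁ (proj₂ forest)

      covered : ∀ v → Connected G S v (vx 0) ⊎ Connected G S v (vx tp)
      covered = proj₂ (proj₂ forest)

      pos-injective : ∀ {f g} → f ∈ S → g ∈ S → pos f ≡ pos g → f ≡ g
      pos-injective {f} {g} f∈S g∈S eq with f ≟ᶠ g
      ... | yes f≡g = f≡g
      ... | no f≢g = ⊥-elim (acyclic (parallel⇒HasCycle f≢g f∈S g∈S (Joins-pos f) Jg (vx≢vx-suc (pos<n f))))
        where
        Jg : Joins G g (vx (pos f)) (vx (suc (pos f)))
        Jg = subst (λ p → Joins G g (vx p) (vx (suc p))) (sym eq) (Joins-pos g)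

      -- The vertices strictly between two unused positions on the same arc reach no root.
      no-two-gaps : ∀ {p q} → p < q → q < n → ¬ Used S p → ¬ Used S q → q < tp ⊎ tp ≤ p → ⊥
      no-two-gaps {p} {q} p<q q<n ¬used-p ¬used-q same-arc = [ ¬at-0 , ¬at-tp ] (covered (vx (suc p)))
        where
        closed : Closed (const ⊤) (InArc p q ∘ toℕ)
        closed = InArc-closed q<n λ f∈S _ →
          (λ eq → ¬used-p (_ , f∈S , eq)) , (λ eq → ¬used-q (_ , f∈S , eq))

        start : InArc p q (toℕ (vx (suc p)))
        start = subst (InArc p q) (sym (toℕ-vx (≤-<-trans p<q q<n))) (≤-refl , p<q)

        ¬at-0 : ¬ Connected G S (vx (suc p)) (vx 0)
        ¬at-0 c = ¬InArc-0 (Connected-preserves closed c start)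

        ¬at-tp : ¬ Connected G S (vx (suc p)) (vx tp)
        ¬at-tp c with subst (InArc p q) (toℕ-vx tp<n) (Connected-preserves closed c start)
        ... | p<tp , tp≤q = [ (λ q<tp → <⇒≱ q<tp tp≤q) , <⇒≱ p<tp ] same-arc

      gaps-coincide : ∀ {x y} → x < n → y < n → ¬ Used S x → ¬ Used S y →
        (x < tp × y < tp) ⊎ (tp ≤ x × tp ≤ y) → x ≡ y
      gaps-coincide {x} {y} x<n y<n ¬used-x ¬used-y same-arc with <-cmp x y
      ... | tri< x<y _ _ = ⊥-elim (no-two-gaps x<y y<n ¬used-x ¬used-y (Sum.map proj₂ proj₁ same-arc))
      ... | tri≈ _ x≡y _ = x≡y
      ... | tri> _ _ y<x = ⊥-elim (no-two-gaps y<x x<n ¬used-y ¬used-x (Sum.map proj₁ proj₂ same-arc))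

    IsTwoRootedForest⇒CutAt : ∃₂ λ a b → CutAt S a b
    IsTwoRootedForest⇒CutAt
      with connected-or-gap {S} (≤⇒≤′ (z≤n {tp})) | connected-or-gap {S} (≤⇒≤′ (<⇒≤ tp<n))
    ... | inj₁ c | _ = ⊥-elim (separated c)
    ... | _ | inj₁ c = ⊥-elim (separated (Connected-sym (subst (Connected G S (vx tp)) vx-n≡vx-0 c)))
    ... | inj₂ (a , _ , a<tp , ¬used-a) | inj₂ (b , tp≤b , b<n , ¬used-b) = a , b , record
      { a<tp = a<tp
      ; tp≤b = tp≤b
      ; b<n = b<n
      ; a-unused = ¬used-a
      ; b-unused = ¬used-b
      ; others-used = others-used
      ; pos-injective = pos-injective
      }
      where
      others-used : ∀ {j} → j < n → j ≢ a → j ≢ b → Used S j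
      others-used {j} j<n j≢a j≢b with Used? S j | j <? tp
      ... | yes used | _ = used
      ... | no ¬used | yes j<tp =
        ⊥-elim (j≢a (gaps-coincide j<n (<-trans a<tp tp<n) ¬used ¬used-a (inj₁ (j<tp , a<tp))))
      ... | no ¬used | no j≮tp =
        ⊥-elim (j≢b (gaps-coincide j<n b<n ¬used ¬used-b (inj₂ (≮⇒≥ j≮tp , tp≤b))))

  CutAt-unique : ∀ {S a b a′ b′} → CutAt S a b → CutAt S a′ b′ → a ≡ a′ × b ≡ b′
  CutAt-unique cut cut′ =
    [ id , ⊥-elim ∘ <⇒≢ (<-≤-trans a<tp (CutAt.tp≤b cut′)) ] (unused⇒cut cut′ (<-trans a<tp tp<n) a-unused) ,
    [ ⊥-elim ∘ <⇒≢ (<-≤-trans (CutAt.a<tp cut′) tp≤b) ∘ sym , id ] (unused⇒cut cut′ b<n b-unused)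
    where open CutAt cut

  CutAt-⊆ : ∀ {S S′ a b} → CutAt S a b → CutAt S′ a b →
    (extra ∈ S → extra ∈ S′) → (extra ∈ S′ → extra ∈ S) → S ⊆ S′
  CutAt-⊆ cut cut′ extra⁺ extra⁻ {f} f∈S
    with CutAt.others-used cut′ (pos<n f) (pos≢a cut f∈S) (pos≢b cut f∈S)
  ... | g , g∈S′ , pos-g≡pos-f with f ≟ᶠ g
  ...   | yes refl = g∈S′
  ...   | no f≢g with twins f≢g (sym pos-g≡pos-f)
  ...     | inj₁ (refl , _) = extra⁺ f∈S
  ...     | inj₂ (_ , refl) =
    ⊥-elim (f≢g (CutAt.pos-injective cut f∈S (extra⁻ g∈S′) (sym pos-g≡pos-f)))

  twin : Bool → Fin (suc n)
  twin true = extra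
  twin false = cyc ip

  pos-twin : ∀ c → pos (twin c) ≡ ip
  pos-twin true = pos-extra
  pos-twin false = pos-cyc ip<n

  twin≢cyc : ∀ c {x} → x < n → x ≢ ip → twin c ≢ cyc x
  twin≢cyc true _ _ = cyc≢extra ∘ sym
  twin≢cyc false x<n x≢ip eq = x≢ip (sym (cyc-injective ip<n x<n eq))

  twin≢twin-not : ∀ c → twin c ≢ twin (not c)
  twin≢twin-not true = cyc≢extra ∘ sym
  twin≢twin-not false = cyc≢extra

  Code : Set
  Code = (ℕ × Bool) × ℕ

  -- The code ((a , c) , b): cut at positions a and b, and use the extra edge iff c.
  -- Opaque, so that a, c and b can be inferred from forestOf ((a , c) , b).
  opaque
    forestOf : Code → Subset (suc n)
    forestOf ((a , c) , b) = ∁ (⁅ cyc a ⁆ ∪ ⁅ cyc b ⁆ ∪ ⁅ twin (not c) ⁆)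

    ∈forestOf⁺ : ∀ {a c b f} → f ≢ cyc a → f ≢ cyc b → f ≢ twin (not c) →
      f ∈ forestOf ((a , c) , b)
    ∈forestOf⁺ f≢a f≢b f≢t = x∉p⇒x∈∁p λ f∈ →
      [ f≢a ∘ x∈⁅y⁆⇒x≡y _ , [ f≢b ∘ x∈⁅y⁆⇒x≡y _ , f≢t ∘ x∈⁅y⁆⇒x≡y _ ] ∘ x∈p∪q⁻ _ _ ] (x∈p∪q⁻ _ _ f∈)

    ∈forestOf⁻ : ∀ {a c b f} → f ∈ forestOf ((a , c) , b) →
      f ≢ cyc a × f ≢ cyc b × f ≢ twin (not c)
    ∈forestOf⁻ f∈ =
      (λ { refl → x∈∁p⇒x∉p f∈ (x∈p∪q⁺ (inj₁ (x∈⁅x⁆ _))) }) ,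
      (λ { refl → x∈∁p⇒x∉p f∈ (x∈p∪q⁺ (inj₂ (x∈p∪q⁺ (inj₁ (x∈⁅x⁆ _))))) }) ,
      (λ { refl → x∈∁p⇒x∉p f∈ (x∈p∪q⁺ (inj₂ (x∈p∪q⁺ (inj₂ (x∈⁅x⁆ _))))) })

  extra∈forestOf : ∀ {a b} → extra ∈ forestOf ((a , true) , b)
  extra∈forestOf = ∈forestOf⁺ (cyc≢extra ∘ sym) (cyc≢extra ∘ sym) (twin≢twin-not true)

  uses-extra : ∀ {a c b} → extra ∈ forestOf ((a , c) , b) → c ≡ true
  uses-extra {c = true} _ = refl
  uses-extra {c = false} extra∈ = ⊥-elim (proj₂ (proj₂ (∈forestOf⁻ extra∈)) refl)

  uses-cyc : ∀ {a c b} → cyc ip ∈ forestOf ((a , c) , b) → c ≡ false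
  uses-cyc {c = true} cyc∈ = ⊥-elim (proj₂ (proj₂ (∈forestOf⁻ cyc∈)) refl)
  uses-cyc {c = false} _ = refl

  Valid : Code → Set
  Valid ((a , c) , b) = a < tp × tp ≤ b × b < n × (c ≡ true → a ≢ ip)

  off-cycle : ∀ {f x} → pos f ≡ x → f ≢ cyc x → f ≡ extra × x ≡ ip
  off-cycle {f} eq f≢cyc with extra-or-cyc f
  ... | inj₁ refl = refl , trans (sym eq) pos-extra
  ... | inj₂ f≡cyc = ⊥-elim (f≢cyc (trans f≡cyc (cong cyc eq)))

  forestOf-CutAt : ∀ {a c b} → Valid ((a , c) , b) → CutAt (forestOf ((a , c) , b)) a b
  forestOf-CutAt {a} {c} {b} (a<tp , tp≤b , b<n , uses-extra⇒a≢ip) = record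
    { a<tp = a<tp
    ; tp≤b = tp≤b
    ; b<n = b<n
    ; a-unused = a-unused
    ; b-unused = b-unused
    ; others-used = others-used
    ; pos-injective = pos-injective
    }
    where
    a<n : a < n
    a<n = <-trans a<tp tp<n

    a-unused : ¬ Used (forestOf ((a , c) , b)) a
    a-unused (f , f∈ , eq) with off-cycle eq (proj₁ (∈forestOf⁻ f∈))
    ... | refl , a≡ip = uses-extra⇒a≢ip (uses-extra f∈) a≡ip

    b-unused : ¬ Used (forestOf ((a , c) , b)) b
    b-unused (f , f∈ , eq) with off-cycle eq (proj₁ (proj₂ (∈forestOf⁻ f∈)))
    ... | _ , b≡ip = <⇒≢ (<-≤-trans ip<tp tp≤b) (sym b≡ip)

    others-used : ∀ {j} → j < n → j ≢ a → j ≢ b → Used (forestOf ((a , c) , b)) j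
    others-used {j} j<n j≢a j≢b with j ≟ ip
    ... | yes refl =
      twin c ,
      ∈forestOf⁺ (twin≢cyc c a<n (j≢a ∘ sym)) (twin≢cyc c b<n (j≢b ∘ sym)) (twin≢twin-not c) ,
      pos-twin c
    ... | no j≢ip =
      cyc j ,
      ∈forestOf⁺ (j≢a ∘ cyc-injective j<n a<n) (j≢b ∘ cyc-injective j<n b<n)
                 (twin≢cyc (not c) j<n j≢ip ∘ sym) ,
      pos-cyc j<n

    pos-injective : ∀ {f g} → f ∈ forestOf ((a , c) , b) → g ∈ forestOf ((a , c) , b) →
      pos f ≡ pos g → f ≡ g
    pos-injective {f} {g} f∈ g∈ eq with f ≟ᶠ g
    ... | yes f≡g = f≡g
    ... | no f≢g with twins f≢g eq
    ...   | inj₁ (refl , refl) with () ← trans (sym (uses-extra f∈)) (uses-cyc g∈)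
    ...   | inj₂ (refl , refl) with () ← trans (sym (uses-extra g∈)) (uses-cyc f∈)

  forestOf-injective : ∀ {κ κ′} → Valid κ → Valid κ′ → forestOf κ ≡ forestOf κ′ → κ ≡ κ′
  forestOf-injective {(a , c) , b} {(a′ , c′) , b′} valid valid′ eq
    with CutAt-unique (forestOf-CutAt valid)
                      (subst (λ S → CutAt S a′ b′) (sym eq) (forestOf-CutAt valid′))
  ... | refl , refl = cong (λ c → (a , c) , b) (same-c c c′ eq)
    where
    same-c : ∀ c c′ → forestOf ((a , c) , b) ≡ forestOf ((a , c′) , b) → c ≡ c′
    same-c true true _ = refl
    same-c false false _ = refl
    same-c true false eq = sym (uses-extra (subst (extra ∈_) eq extra∈forestOf))
    same-c false true eq = uses-extra (subst (extra ∈_) (sym eq) extra∈forestOf)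

  CutAt⇒forestOf : ∀ {S a b c} → CutAt S a b → (extra ∈ S → c ≡ true) → (c ≡ true → extra ∈ S) →
    Valid ((a , c) , b) × forestOf ((a , c) , b) ≡ S
  CutAt⇒forestOf {S} {a} {b} {c} cut extra∈S⇒c c⇒extra∈S =
    valid ,
    ⊆-antisym (CutAt-⊆ cut-κ cut (c⇒extra∈S ∘ uses-extra) (extra∈forestOf-c ∘ extra∈S⇒c))
              (CutAt-⊆ cut cut-κ (extra∈forestOf-c ∘ extra∈S⇒c) (c⇒extra∈S ∘ uses-extra))
    where
    open CutAt cut
    valid : Valid ((a , c) , b)
    valid = a<tp , tp≤b , b<n ,
            λ c≡true a≡ip → a-unused (extra , c⇒extra∈S c≡true , trans pos-extra (sym a≡ip))
    cut-κ : CutAt (forestOf ((a , c) , b)) a b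
    cut-κ = forestOf-CutAt valid
    extra∈forestOf-c : c ≡ true → extra ∈ forestOf ((a , c) , b)
    extra∈forestOf-c refl = extra∈forestOf

  ipᶠ : Fin tp
  ipᶠ = fromℕ< ip<tp

  arcCodes : List (ℕ × Bool)
  arcCodes = map (_, false) (upTo tp) ++ map (λ k → toℕ (punchIn ipᶠ k) , true) (allFin tq)

  ∈arcCodes⁺ : ∀ {a c} → a < tp → (c ≡ true → a ≢ ip) → (a , c) ∈ₗ arcCodes
  ∈arcCodes⁺ {a} {false} a<tp _ = ∈-++⁺ˡ (∈-map⁺ (_, false) (∈-upTo⁺ a<tp))
  ∈arcCodes⁺ {a} {true} a<tp a≢ip =
    ∈-++⁺ʳ (map (_, false) (upTo tp))
      (subst (λ x → (x , true) ∈ₗ _) toℕ-punchIn (∈-map⁺ _ (∈-allFin (punchOut ip≢a))))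
    where
    ip≢a : ipᶠ ≢ fromℕ< a<tp
    ip≢a eq = a≢ip refl (trans (sym (toℕ-fromℕ< a<tp)) (trans (cong toℕ (sym eq)) (toℕ-fromℕ< ip<tp)))
    toℕ-punchIn : toℕ (punchIn ipᶠ (punchOut ip≢a)) ≡ a
    toℕ-punchIn = trans (cong toℕ (punchIn-punchOut ip≢a)) (toℕ-fromℕ< a<tp)

  ∈arcCodes⁻ : ∀ {a c} → (a , c) ∈ₗ arcCodes → a < tp × (c ≡ true → a ≢ ip)
  ∈arcCodes⁻ a∈ with ∈-++⁻ (map (_, false) (upTo tp)) a∈
  ... | inj₁ a∈ˡ with ∈-map⁻ (_, false) a∈ˡ
  ...   | _ , k∈ , refl = ∈-upTo⁻ k∈ , λ ()
  ∈arcCodes⁻ a∈ | inj₂ a∈ʳ with ∈-map⁻ (λ k → toℕ (punchIn ipᶠ k) , true) a∈ʳ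
  ...   | k , _ , refl =
    toℕ<n (punchIn ipᶠ k) , λ _ eq → punchInᵢ≢i ipᶠ k (toℕ-injective (trans eq (sym (toℕ-fromℕ< ip<tp))))

  arcCodes! : Unique arcCodes
  arcCodes! = ++⁺ (map⁺ ,-injectiveˡ (upTo⁺ tp))
                  (map⁺ (punchIn-injective ipᶠ _ _ ∘ toℕ-injective ∘ ,-injectiveˡ) (allFin⁺ tq))
                  disjoint
    where
    disjoint : ∀ {x} →
      ¬ (x ∈ₗ map (_, false) (upTo tp) × x ∈ₗ map (λ k → toℕ (punchIn ipᶠ k) , true) (allFin tq))
    disjoint (x∈ˡ , x∈ʳ) with ∈-map⁻ (_, false) x∈ˡ | ∈-map⁻ (λ k → toℕ (punchIn ipᶠ k) , true) x∈ʳ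
    ... | _ , _ , refl | _ , _ , ()

  cutCodes : List ℕ
  cutCodes = map (tp +_) (upTo (n ∸ tp))

  ∈cutCodes⁺ : ∀ {b} → tp ≤ b → b < n → b ∈ₗ cutCodes
  ∈cutCodes⁺ tp≤b b<n =
    subst (_∈ₗ cutCodes) (m+[n∸m]≡n tp≤b) (∈-map⁺ (tp +_) (∈-upTo⁺ (∸-monoˡ-< b<n tp≤b)))

  ∈cutCodes⁻ : ∀ {b} → b ∈ₗ cutCodes → tp ≤ b × b < n
  ∈cutCodes⁻ b∈ with ∈-map⁻ (tp +_) b∈
  ... | k , k∈ , refl =
    m≤m+n tp k , subst (tp + k <_) (m+[n∸m]≡n (<⇒≤ tp<n)) (+-monoʳ-< tp (∈-upTo⁻ k∈))

  codes : List Code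
  codes = cartesianProduct arcCodes cutCodes

  ∈codes⁺ : ∀ {κ} → Valid κ → κ ∈ₗ codes
  ∈codes⁺ {(_ , _) , _} (a<tp , tp≤b , b<n , c⇒a≢ip) =
    ∈-cartesianProduct⁺ (∈arcCodes⁺ a<tp c⇒a≢ip) (∈cutCodes⁺ tp≤b b<n)

  ∈codes⁻ : ∀ {κ} → κ ∈ₗ codes → Valid κ
  ∈codes⁻ {(_ , _) , _} κ∈ with ∈-cartesianProduct⁻ arcCodes cutCodes κ∈
  ... | ac∈ , b∈ = let a<tp , c⇒a≢ip = ∈arcCodes⁻ ac∈ ; tp≤b , b<n = ∈cutCodes⁻ b∈ in
    a<tp , tp≤b , b<n , c⇒a≢ip

  codes! : Unique codes
  codes! = cartesianProduct⁺ arcCodes! (map⁺ (+-cancelˡ-≡ tp _ _) (upTo⁺ (n ∸ tp)))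

  length-codes : length codes ≡ (tp + tq) * (n ∸ tp)
  length-codes = begin
    length codes                                 ≡⟨ length-cartesianProduct arcCodes cutCodes ⟩
    length arcCodes * length cutCodes            ≡⟨ cong₂ _*_ length-arcCodes length-cutCodes ⟩
    (tp + tq) * (n ∸ tp)                         ∎
    where
    open ≡-Reasoning
    length-arcCodes : length arcCodes ≡ tp + tq
    length-arcCodes = begin
      length arcCodes                                          ≡⟨ length-++ (map (_, false) (upTo tp)) ⟩
      length (map (_, false) (upTo tp)) + length (map _ (allFin tq))
        ≡⟨ cong₂ _+_ (trans (length-map _ (upTo tp)) (length-upTo tp))
                     (trans (length-map _ (allFin tq)) (length-tabulate _)) ⟩
      tp + tq                                                  ∎
    length-cutCodes : length cutCodes ≡ n ∸ tp
    length-cutCodes = trans (length-map (tp +_) (upTo (n ∸ tp))) (length-upTo (n ∸ tp))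

  count : F₂≡ G (vx 0) (vx tp) ((tp + tq) * (n ∸ tp))
  count = subst (F₂≡ G (vx 0) (vx tp)) length-codes
    (HasCount-enumeration forestOf codes!
      (λ κ∈ κ′∈ → forestOf-injective (∈codes⁻ κ∈) (∈codes⁻ κ′∈))
      (λ κ∈ → CutAt⇒IsTwoRootedForest (forestOf-CutAt (∈codes⁻ κ∈)))
      complete)
    where
    complete : ∀ {S} → IsTwoRootedForest G (vx 0) (vx tp) S → ∃ λ κ → κ ∈ₗ codes × forestOf κ ≡ S
    complete {S} forest with IsTwoRootedForest⇒CutAt forest | extra ∈? S
    ... | a , b , cut | yes extra∈S =
      let valid , eq = CutAt⇒forestOf cut (const refl) (const extra∈S)
      in ((a , true) , b) , ∈codes⁺ valid , eq
    ... | a , b , cut | no extra∉S =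
      let valid , eq = CutAt⇒forestOf cut (⊥-elim ∘ extra∉S) (λ ())
      in ((a , false) , b) , ∈codes⁺ valid , eq

lemma7p5 : (n t i : ℕ) .{{_ : NonZero n}} → 3 ≤ n → 2 ≤ t → t ≤ ⌈ n /2⌉ → 1 ≤ i → i < t →
    ((i ≡ 1 × t ≡ 2) → F₂≡ (Cn n i) (vtx n 1) (vtx n t) (n ∸ 1)) ×
    (¬ (i ≡ 1 × t ≡ 2) → F₂≡ (Cn n i) (vtx n 1) (vtx n t) ((2 * t ∸ 3) * (n ∸ t + 1)))
lemma7p5 n (suc (suc tq)) (suc ip) _ _ t≤⌈n/2⌉ _ (s≤s (s≤s ip≤tq)) =
  (λ { (refl , refl) → subst (F₂≡ G (vx 0) (vx tp)) (*-identityˡ (n ∸ 1)) count }) ,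
  (λ _ → subst (F₂≡ G (vx 0) (vx tp)) (sym closed-form) count)
  where
  t≤n : suc (suc tq) ≤ n
  t≤n = ≤-trans t≤⌈n/2⌉ (⌈n/2⌉≤n n)

  open TwoRootedForests n tq ip ip≤tq t≤n

  first-arc-choices : 2 * suc tp ∸ 3 ≡ tp + tq
  first-arc-choices = begin
    2 * suc tp ∸ 3        ≡⟨⟩
    tq + (suc tp + 0) ∸ 1 ≡⟨ cong (λ m → tq + m ∸ 1) (+-identityʳ (suc tp)) ⟩
    tq + suc tp ∸ 1       ≡⟨ cong (_∸ 1) (+-suc tq tp) ⟩
    tq + tp               ≡⟨ +-comm tq tp ⟩
    tp + tq               ∎
    where open ≡-Reasoning

  closed-form : (2 * suc tp ∸ 3) * (n ∸ suc tp + 1) ≡ (tp + tq) * (n ∸ tp)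
  closed-form = cong₂ _*_ first-arc-choices (trans (+-comm (n ∸ suc tp) 1) (sym (+-∸-assoc 1 t≤n)))
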